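{- For every sequence $\alpha:\mathbb{N}\to\mathbb{N}$ and every closed System T term $t$ of type $(\iota\Rightarrow\iota)\Rightarrow\iota$, we have $[\![t]\!]\,\alpha = \mathsf{dialogue}\,(\mathsf{dialogueTree}(t))\,\alpha$.
   Context: Metatheory: constructive Martin-Löf type theory (with $\Pi$, $\Sigma$, inductive types, a universe), without function extensionality; "$=$" is the identity type. $\mathsf{Natrec}\,f\,x\,0 = x$, $\mathsf{Natrec}\,f\,x\,(n+1) = f\,n\,(\mathsf{Natrec}\,f\,x\,n)$. System T: types are generated by a base type $\iota$ and function types $\sigma\Rightarrow\tau$. Contexts are finite lists of distinct typed variables. Terms $\Gamma\vdash t:\sigma$ are: variables $x$ with $(x:\sigma)\in\Gamma$; $\mathsf{zero}:\iota$; $\mathsf{succ}\,t:\iota$ for $t:\iota$; $\mathsf{rec}_\sigma\,t\,p\,q:\sigma$ for $t:\iota\Rightarrow\sigma\Rightarrow\sigma$, $p:\sigma$, $q:\iota$; $\lambda x{:}\sigma.\,t:\sigma\Rightarrow\tau$ for $\Gamma,x{:}\sigma\vdash t:\tau$; application $t\,p:\tau$ for $t:\sigma\Rightarrow\tau$, $p:\sigma$. Closed terms are terms in the empty context. Set interpretation: $[\![\iota]\!]=\mathbb{N}$, $[\![\sigma\Rightarrow\tau]\!]=[\![\sigma]\!]\to[\![\tau]\!]$; for an assignment $\gamma$ of elements of $[\![\sigma]\!]$ to each $(x:\sigma)\in\Gamma$: $[\![x]\!]\gamma=\gamma(x)$, $[\![\mathsf{zero}]\!]\gamma=0$, $[\![\mathsf{succ}\,t]\!]\gamma=[\![t]\!]\gamma+1$,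 $[\![\mathsf{rec}_\sigma\,t_1\,t_2\,t_3]\!]\gamma=\mathsf{Natrec}([\![t_1]\!]\gamma)([\![t_2]\!]\gamma)([\![t_3]\!]\gamma)$, $[\![\lambda x.t]\!]\gamma=\lambda a.[\![t]\!](\gamma,x\mapsto a)$, $[\![t\,p]\!]\gamma=[\![t]\!]\gamma\,([\![p]\!]\gamma)$. For closed $t$ write $[\![t]\!]$. Dialogue trees: for types $I,O,X$, $\mathcal{D}(I,O,X)$ is the inductive type with constructors $\eta\,x$ ($x:X$) and $\beta\,\varphi\,i$ ($\varphi:O\to\mathcal{D}(I,O,X)$, $i:I$); $\mathcal{D}_{\mathbb N}X:=\mathcal{D}(\mathbb{N},\mathbb{N},X)$. $\mathsf{dialogue}(\eta\,x)\,\alpha=x$, $\mathsf{dialogue}(\beta\,\varphi\,i)\,\alpha=\mathsf{dialogue}(\varphi(\alpha\,i))\,\alpha$. Kleisli extension: for $f:X\to\mathcal{D}(I,O,Y)$, $f^\sharp(\eta\,x)=f\,x$, $f^\sharp(\beta\,\varphi\,i)=\beta\,(\lambda o.f^\sharp(\varphi\,o))\,i$; $\mathsf{map}\,f:=(\eta\circ f)^\sharp$. Dialogue interpretation: $\mathcal{B}[\![\iota]\!]=\mathcal{D}_{\mathbb N}\mathbb{N}$, $\mathcal{B}[\![\sigma\Rightarrow\tau]\!]=\mathcal{B}[\![\sigma]\!]\to\mathcal{B}[\![\tau]\!]$. Generalised Kleisli extension $\mathsf{ext}_\sigma:(\mathbb{N}\to\mathcal{B}[\![\sigma]\!])\to\mathcal{D}_{\mathbb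 N}\mathbb{N}\to\mathcal{B}[\![\sigma]\!]$: $\mathsf{ext}_\iota\,f\,d=f^\sharp\,d$, $\mathsf{ext}_{\sigma_1\Rightarrow\sigma_2}\,f\,d\,s=\mathsf{ext}_{\sigma_2}(\lambda x.f\,x\,s)\,d$. For $\gamma$ assigning elements of $\mathcal{B}[\![\sigma]\!]$ to variables: $\mathcal{B}[\![x]\!]\gamma=\gamma(x)$, $\mathcal{B}[\![\mathsf{zero}]\!]\gamma=\eta\,0$, $\mathcal{B}[\![\mathsf{succ}\,t]\!]\gamma=\mathsf{map}(\lambda n.n+1)(\mathcal{B}[\![t]\!]\gamma)$, $\mathcal{B}[\![\mathsf{rec}_\sigma\,t_1\,t_2\,t_3]\!]\gamma=\mathsf{ext}_\sigma(\mathsf{Natrec}(\mathcal{B}[\![t_1]\!]\gamma\circ\eta)(\mathcal{B}[\![t_2]\!]\gamma))(\mathcal{B}[\![t_3]\!]\gamma)$, $\mathcal{B}[\![\lambda x.t]\!]\gamma=\lambda a.\mathcal{B}[\![t]\!](\gamma,x\mapsto a)$, $\mathcal{B}[\![t\,p]\!]\gamma=\mathcal{B}[\![t]\!]\gamma(\mathcal{B}[\![p]\!]\gamma)$. The generic sequence is $\mathsf{generic}:=(\lambda i.\beta\,\eta\,i)^\sharp:\mathcal{D}_{\mathbb N}\mathbb{N}\to\mathcal{D}_{\mathbb N}\mathbb{N}$, and for closed $t:(\iota\Rightarrow\iota)\Rightarrow\iota$, $\mathsf{dialogueTree}(t):=\mathcal{B}[\![t]\!]\,\mathsf{generic}\in\mathcal{D}_{\mathbb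 N}\mathbb{N}$. -}

module Defs where

open import Data.Nat using (ℕ; zero; suc)
open import Data.List using (List; []; _∷_)

Natrec : {A : Set} → (ℕ → A → A) → A → ℕ → A
Natrec f x zero    = x
Natrec f x (suc n) = f n (Natrec f x n)

infixr 20 _⇒_
data Type : Set where
  ι   : Type
  _⇒_ : Type → Type → Type

Cxt : Set
Cxt = List Type

data _∋_ : Cxt → Type → Set where
  here  : ∀ {Γ σ} → (σ ∷ Γ) ∋ σ
  there : ∀ {Γ σ τ} → Γ ∋ σ → (τ ∷ Γ) ∋ σ

data T (Γ : Cxt) : Type → Set where
  var  : ∀ {σ} → Γ ∋ σ → T Γ σ
  zero : T Γ ι
  succ : T Γ ι → T Γ ι
  rec  : ∀ {σ} → T Γ (ι ⇒ σ ⇒ σ) → T Γ σ → T Γ ι → T Γ σ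
  lam  : ∀ {σ τ} → T (σ ∷ Γ) τ → T Γ (σ ⇒ τ)
  _·_  : ∀ {σ τ} → T Γ (σ ⇒ τ) → T Γ σ → T Γ τ

⟦_⟧ᵀ : Type → Set
⟦ ι ⟧ᵀ = ℕ
⟦ σ ⇒ τ ⟧ᵀ = ⟦ σ ⟧ᵀ → ⟦ τ ⟧ᵀ

Env : (Type → Set) → Cxt → Set
Env S Γ = ∀ {σ} → Γ ∋ σ → S σ

ε : {S : Type → Set} → Env S []
ε ()

_,,_ : {S : Type → Set} {Γ : Cxt} {σ : Type} → Env S Γ → S σ → Env S (σ ∷ Γ)
(γ ,, a) here      = a
(γ ,, a) (there x) = γ x

⟦_⟧ : ∀ {Γ σ} → T Γ σ → Env ⟦_⟧ᵀ Γ → ⟦ σ ⟧ᵀ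
⟦ var x ⟧ γ = γ x
⟦ zero ⟧ γ = 0
⟦ succ t ⟧ γ = suc (⟦ t ⟧ γ)
⟦ rec t p q ⟧ γ = Natrec (⟦ t ⟧ γ) (⟦ p ⟧ γ) (⟦ q ⟧ γ)
⟦ lam t ⟧ γ = λ a → ⟦ t ⟧ (γ ,, a)
⟦ t · p ⟧ γ = ⟦ t ⟧ γ (⟦ p ⟧ γ)

⟦_⟧₀ : ∀ {σ} → T [] σ → ⟦ σ ⟧ᵀ
⟦ t ⟧₀ = ⟦ t ⟧ (ε {⟦_⟧ᵀ})

data D (I O X : Set) : Set where
  η : X → D I O X
  β : (O → D I O X) → I → D I O X

Dℕ : Set → Set
Dℕ X = D ℕ ℕ X

dialogue : {X : Set} → Dℕ X → (ℕ → ℕ) → X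
dialogue (η x)   α = x
dialogue (β φ i) α = dialogue (φ (α i)) α

kleisli : {I O X Y : Set} → (X → D I O Y) → D I O X → D I O Y
kleisli f (η x)   = f x
kleisli f (β φ i) = β (λ o → kleisli f (φ o)) i

mapD : {I O X Y : Set} → (X → Y) → D I O X → D I O Y
mapD f = kleisli (λ x → η (f x))

B⟦_⟧ᵀ : Type → Set
B⟦ ι ⟧ᵀ = Dℕ ℕ
B⟦ σ ⇒ τ ⟧ᵀ = B⟦ σ ⟧ᵀ → B⟦ τ ⟧ᵀ

ext : (σ : Type) → (ℕ → B⟦ σ ⟧ᵀ) → Dℕ ℕ → B⟦ σ ⟧ᵀ
ext ι f d = kleisli f d
ext (σ₁ ⇒ σ₂) f d s = ext σ₂ (λ x → f x s) d

B⟦_⟧ : ∀ {Γ σ} → T Γ σ → Env B⟦_⟧ᵀ Γ → B⟦ σ ⟧ᵀ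
B⟦ var x ⟧ γ = γ x
B⟦ zero ⟧ γ = η 0
B⟦ succ t ⟧ γ = mapD suc (B⟦ t ⟧ γ)
B⟦ rec {σ} t p q ⟧ γ =
  ext σ (Natrec (λ n → B⟦ t ⟧ γ (η n)) (B⟦ p ⟧ γ)) (B⟦ q ⟧ γ)
B⟦ lam t ⟧ γ = λ a → B⟦ t ⟧ (γ ,, a)
B⟦ t · p ⟧ γ = B⟦ t ⟧ γ (B⟦ p ⟧ γ)

generic : Dℕ ℕ → Dℕ ℕ
generic = kleisli (λ i → β η i)

dialogueTree : T [] ((ι ⇒ ι) ⇒ ι) → Dℕ ℕ
dialogueTree t = B⟦ t ⟧ (ε {B⟦_⟧ᵀ}) generic

-- Relate a set-theoretic value to a dialogue value by a logical relation R_α indexed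
-- by the type, which at ι says that the dialogue tree evaluated along α yields the
-- number. Every term maps related environments to related values (the fundamental
-- lemma); the generic sequence is related to α itself, since evaluating it along α
-- queries α at the index computed so far.
module Submission where

open import Defs
open import Data.Nat using (ℕ; zero; suc)
open import Data.List using ([]; _∷_)
open import Relation.Binary.PropositionalEquality using (_≡_; refl; sym; trans; cong)

module _ (α : ℕ → ℕ) where

  dialogue-kleisli : {X Y : Set} (f : X → Dℕ Y) (d : Dℕ X) →
                     dialogue (kleisli f d) α ≡ dialogue (f (dialogue d α)) α
  dialogue-kleisli f (η x)   = refl
  dialogue-kleisli f (β φ i) = dialogue-kleisli f (φ (α i))

  R : (σ : Type) → ⟦ σ ⟧ᵀ → B⟦ σ ⟧ᵀ → Set
  R ι       n d = n ≡ dialogue d α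
  R (σ ⇒ τ) f g = ∀ x y → R σ x y → R τ (f x) (g y)

  R-ext : (σ : Type) (f : ℕ → ⟦ σ ⟧ᵀ) (g : ℕ → B⟦ σ ⟧ᵀ) →
          (∀ k → R σ (f k) (g k)) → ∀ n d → R ι n d → R σ (f n) (ext σ g d)
  R-ext ι       f g fRg n d refl = trans (fRg (dialogue d α)) (sym (dialogue-kleisli g d))
  R-ext (σ ⇒ τ) f g fRg n d nRd x y xRy =
    R-ext τ (λ k → f k x) (λ k → g k y) (λ k → fRg k x y xRy) n d nRd

  R-Natrec : (σ : Type) (f : ⟦ ι ⇒ σ ⇒ σ ⟧ᵀ) (g : B⟦ ι ⇒ σ ⇒ σ ⟧ᵀ) → R (ι ⇒ σ ⇒ σ) f g →
             ∀ x y → R σ x y → ∀ k → R σ (Natrec f x k) (Natrec (λ n → g (η n)) y k)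
  R-Natrec σ f g fRg x y xRy zero    = xRy
  R-Natrec σ f g fRg x y xRy (suc k) = fRg k (η k) refl _ _ (R-Natrec σ f g fRg x y xRy k)

  R-generic : R (ι ⇒ ι) α generic
  R-generic i d refl = sym (dialogue-kleisli (β η) d)

  REnv : ∀ Γ → Env ⟦_⟧ᵀ Γ → Env B⟦_⟧ᵀ Γ → Set
  REnv Γ γ δ = ∀ {σ} (v : Γ ∋ σ) → R σ (γ v) (δ v)

  REnv-ε : REnv [] (ε {⟦_⟧ᵀ}) (ε {B⟦_⟧ᵀ})
  REnv-ε ()

  REnv-,, : ∀ {Γ σ} {γ : Env ⟦_⟧ᵀ Γ} {δ : Env B⟦_⟧ᵀ Γ} → REnv Γ γ δ →
            ∀ {x y} → R σ x y → REnv (σ ∷ Γ) (γ ,, x) (δ ,, y)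
  REnv-,, γRδ xRy here      = xRy
  REnv-,, γRδ xRy (there v) = γRδ v

  fundamental : ∀ {Γ σ} (t : T Γ σ) {γ : Env ⟦_⟧ᵀ Γ} {δ : Env B⟦_⟧ᵀ Γ} →
                REnv Γ γ δ → R σ (⟦ t ⟧ γ) (B⟦ t ⟧ δ)
  fundamental (var v)  γRδ = γRδ v
  fundamental zero     γRδ = refl
  fundamental (succ t) {δ = δ} γRδ =
    trans (cong suc (fundamental t γRδ)) (sym (dialogue-kleisli (λ n → η (suc n)) (B⟦ t ⟧ δ)))
  fundamental (rec {σ} t p q) {γ} {δ} γRδ =
    R-ext σ _ _
      (R-Natrec σ (⟦ t ⟧ γ) (B⟦ t ⟧ δ) (fundamental t γRδ) _ _ (fundamental p γRδ))
      _ _ (fundamental q γRδ)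
  fundamental (lam t)  γRδ x y xRy = fundamental t (REnv-,, γRδ xRy)
  fundamental (t · p)  γRδ = fundamental t γRδ _ _ (fundamental p γRδ)

theorem16 : (α : ℕ → ℕ) (t : T [] ((ι ⇒ ι) ⇒ ι)) →
            ⟦ t ⟧₀ α ≡ dialogue (dialogueTree t) α
theorem16 α t = fundamental α t (REnv-ε α) α generic (R-generic α)
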